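{- Let $k$ be a fixed positive integer. If $G$ is a graph on $n$ vertices with $\overline{\operatorname{Z}}(G)\le k$, then the number of minimal zero forcing sets of $G$ is $O(n^k)$; in particular, any family of graphs with $\overline{\operatorname{Z}}(G)=O(1)$ has polynomially many (in $n$) minimal zero forcing sets. On the other hand, when $\overline{\operatorname{Z}}(G)=\Omega(n)$ the number of minimal zero forcing sets can be either polynomial or exponential: there is an infinite family of graphs with $\overline{\operatorname{Z}}(G)=\Omega(n)$ having polynomially many minimal zero forcing sets, and an infinite family of graphs with $\overline{\operatorname{Z}}(G)=\Omega(n)$ having exponentially many minimal zero forcing sets.
   Context: All graphs are finite, simple and undirected; $n$ denotes the number of vertices. Given a set $S$ of initially blue vertices (all others white), the zero forcing color change rule says that a blue vertex with exactly one white neighbor causes that neighbor to become blue. The closure of $S$ is the set of blue vertices obtained by applying this rule until no more changes are possible. $S$ is a zero forcing set if its closure is all of $V(G)$. A minimal zero forcing set is a zero forcing set containing no other zero forcing set as a proper subset. $\overline{\operatorname{Z}}(G)$ denotes the maximum size of a minimal zero forcing set of $G$. -}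

module Defs where

open import Data.Nat using (ℕ; _≤_)
open import Data.Bool using (Bool; true; false; T)
open import Data.Fin using (Fin)
open import Data.Fin.Subset using (Subset; _∈_; _⊂_; ∣_∣)
open import Data.Product using (Σ; _×_)
open import Data.List using (List; length)
open import Data.List.Relation.Unary.All using (All)
open import Data.List.Relation.Unary.Unique.Propositional using (Unique)
open import Relation.Binary.PropositionalEquality using (_≡_; _≢_)
open import Relation.Nullary using (¬_)

record Graph (n : ℕ) : Set where
  field
    adj     : Fin n → Fin n → Bool
    symm    : ∀ u v → adj u v ≡ adj v u
    irrefl  : ∀ u → adj u u ≡ false

open Graph public

Adj : ∀ {n} → Graph n → Fin n → Fin n → Set
Adj G u v = T (adj G u v)

-- Closure of S under the zero forcing colour change rule, as the least
-- set of vertices containing S and closed under forcing: a blue vertex u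
-- all of whose neighbours other than v are blue forces its neighbour v.
data Closure {n : ℕ} (G : Graph n) (S : Subset n) : Fin n → Set where
  init  : ∀ {v} → v ∈ S → Closure G S v
  force : ∀ {u v} → Closure G S u → Adj G u v
        → (∀ w → Adj G u w → w ≢ v → Closure G S w)
        → Closure G S v

IsZeroForcingSet : ∀ {n} → Graph n → Subset n → Set
IsZeroForcingSet G S = ∀ v → Closure G S v

IsMinimalZFS : ∀ {n} → Graph n → Subset n → Set
IsMinimalZFS G S = IsZeroForcingSet G S × (∀ T → T ⊂ S → ¬ IsZeroForcingSet G T)

ZbarAtMost : ∀ {n} → Graph n → ℕ → Set
ZbarAtMost G k = ∀ S → IsMinimalZFS G S → ∣ S ∣ ≤ k

ZbarAtLeast : ∀ {n} → Graph n → ℕ → Set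
ZbarAtLeast G k = Σ (Subset _) (λ S → IsMinimalZFS G S × k ≤ ∣ S ∣)

-- A duplicate-free list of minimal zero forcing sets of G.
-- "#minimal ZF sets ≤ b"  is  ∀ L → MinZFSList G L → length L ≤ b,
-- "#minimal ZF sets ≥ b"  is  ∃ L, MinZFSList G L × b ≤ length L.
MinZFSList : ∀ {n} → Graph n → List (Subset n) → Set
MinZFSList G L = Unique L × All (IsMinimalZFS G) L

-- Part (1): a duplicate-free list of subsets of an n-set, each of size at
-- most k, has length at most (n + 1)^k, and under Zbar(G) ≤ k every minimal
-- zero forcing set has size at most k.  Part (2): the edgeless graph on n
-- vertices has V as its only zero forcing set, so Zbar = n and there is just
-- one minimal zero forcing set.  Part (3): in a perfect matching on 2n
-- vertices nothing can be forced from outside an edge, so a set is zero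
-- forcing iff it meets every edge; the 2^n sets picking exactly one end of
-- each edge are therefore minimal, have n elements, and 16^n ≤ 9^n · 2^n.
module Submission where

open import Defs
open import Algebra.Properties.CommutativeSemigroup using (interchange)
open import Data.Bool using (true; false; not)
open import Data.Empty using (⊥-elim)
open import Data.Fin using (Fin; zero; suc; _≟_)
open import Data.Fin.Properties using (suc-injective)
open import Data.Fin.Subset using (Subset; ∣_∣; ⊤; _⊂_; _∉_) renaming (_∈_ to _∈ₛ_)
open import Data.Fin.Subset.Properties using (∈⊤; ⊆⊤; ⊆-antisym; ∣⊤∣≡n)
open import Data.List using (List; []; _∷_; length; map; _++_)
open import Data.List.Membership.Propositional using (_∈_)
open import Data.List.Membership.Propositional.Properties using (∈-map⁺; ∈-map⁻; ∈-++⁺ˡ; ∈-++⁺ʳ)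
open import Data.List.Properties using (length-map; length-++; length-removeAt′)
open import Data.List.Relation.Binary.Subset.Propositional using () renaming (_⊆_ to _⊆ₗ_)
open import Data.List.Relation.Unary.All as All using (All; []; _∷_)
open import Data.List.Relation.Unary.All.Properties using () renaming (map⁺ to All-map⁺)
open import Data.List.Relation.Unary.AllPairs using ([]; _∷_)
open import Data.List.Relation.Unary.Any using (here; there; _─_; index)
open import Data.List.Relation.Unary.Unique.Propositional using (Unique)
open import Data.List.Relation.Unary.Unique.Propositional.Properties
  using (++⁺) renaming (map⁺ to Unique-map⁺)
open import Data.Nat using (ℕ; zero; suc; _+_; _*_; _^_; _≤_; _<_; z≤n; s≤s)
open import Data.Nat.Properties
  using (≤-refl; ≤-reflexive; ≤-trans; n≤1+n; m≤m+n; m≤n+m; +-comm; +-identityʳ; +-mono-≤; +-monoʳ-≤;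
         *-suc; *-identityˡ; *-monoʳ-≤; *-commutativeSemigroup; ^-zeroˡ; ^-*-assoc; ^-monoˡ-≤; m^n>0;
         module ≤-Reasoning)
open import Data.Product using (Σ; _×_; ∃; _,_)
open import Data.Sum using (_⊎_; inj₁; inj₂)
open import Data.Vec using ([]; _∷_; here; there)
open import Data.Vec.Properties using (∷-injectiveˡ; ∷-injectiveʳ)
open import Function.Base using (_∘_)
open import Function.Bundles using (mk⇔)
open import Relation.Binary.PropositionalEquality
open import Relation.Nullary using (¬_; does)
open import Relation.Nullary.Decidable using (⌊_⌋; isYes≗does; does-⇔; dec-false; toWitness; fromWitness)

module _ {A : Set} where

  ∈-─⁺ : ∀ {x y : A} {ys} (y∈ys : y ∈ ys) → x ∈ ys → y ≢ x → x ∈ (ys ─ y∈ys)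
  ∈-─⁺ (here refl) (here refl) y≢x = ⊥-elim (y≢x refl)
  ∈-─⁺ (here _)    (there x∈) _    = x∈
  ∈-─⁺ (there _)   (here x≡)  _    = here x≡
  ∈-─⁺ (there y∈)  (there x∈) y≢x  = there (∈-─⁺ y∈ x∈ y≢x)

  Unique⇒length-≤ : ∀ {xs ys : List A} → Unique xs → xs ⊆ₗ ys → length xs ≤ length ys
  Unique⇒length-≤ {[]}     _              _      = z≤n
  Unique⇒length-≤ {x ∷ xs} {ys} (x∉xs ∷ u) xs⊆ys =
    subst (suc (length xs) ≤_) (sym (length-removeAt′ ys (index x∈ys)))
      (s≤s (Unique⇒length-≤ u λ z∈xs →
        ∈-─⁺ x∈ys (xs⊆ys (there z∈xs)) (All.lookup x∉xs z∈xs)))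
    where x∈ys = xs⊆ys (here refl)

subsets≤ : ∀ n → ℕ → List (Subset n)
subsets≤ zero    _       = [] ∷ []
subsets≤ (suc n) zero    = map (false ∷_) (subsets≤ n zero)
subsets≤ (suc n) (suc k) = map (false ∷_) (subsets≤ n (suc k)) ++ map (true ∷_) (subsets≤ n k)

∈-subsets≤ : ∀ {n} k (S : Subset n) → ∣ S ∣ ≤ k → S ∈ subsets≤ n k
∈-subsets≤ _       []          _       = here refl
∈-subsets≤ zero    (false ∷ S) ∣S∣≤0   = ∈-map⁺ (false ∷_) (∈-subsets≤ zero S ∣S∣≤0)
∈-subsets≤ {suc n} (suc k) (false ∷ S) ∣S∣≤k =
  ∈-++⁺ˡ (∈-map⁺ (false ∷_) (∈-subsets≤ (suc k) S ∣S∣≤k))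
∈-subsets≤ {suc n} (suc k) (true ∷ S) (s≤s ∣S∣≤k) =
  ∈-++⁺ʳ (map (false ∷_) (subsets≤ n (suc k))) (∈-map⁺ (true ∷_) (∈-subsets≤ k S ∣S∣≤k))

length-subsets≤ : ∀ n k → length (subsets≤ n k) ≤ suc n ^ k
length-subsets≤ zero    k    = ≤-reflexive (sym (^-zeroˡ k))
length-subsets≤ (suc n) zero =
  ≤-trans (≤-reflexive (length-map _ (subsets≤ n zero))) (length-subsets≤ n zero)
length-subsets≤ (suc n) (suc k) = begin
    length (map (false ∷_) (subsets≤ n (suc k)) ++ map (true ∷_) (subsets≤ n k))
  ≡⟨ length-++ (map (false ∷_) (subsets≤ n (suc k))) ⟩
    length (map (false ∷_) (subsets≤ n (suc k))) + length (map (true ∷_) (subsets≤ n k))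
  ≡⟨ cong₂ _+_ (length-map _ (subsets≤ n (suc k))) (length-map _ (subsets≤ n k)) ⟩
    length (subsets≤ n (suc k)) + length (subsets≤ n k)
  ≤⟨ +-mono-≤ (length-subsets≤ n (suc k)) (length-subsets≤ n k) ⟩
    suc n * suc n ^ k + suc n ^ k
  ≡⟨ +-comm (suc n * suc n ^ k) _ ⟩
    suc (suc n) * suc n ^ k
  ≤⟨ *-monoʳ-≤ (suc (suc n)) (^-monoˡ-≤ k (n≤1+n (suc n))) ⟩
    suc (suc n) ^ suc k
  ∎
  where open ≤-Reasoning

Unique-subsets≤-length-≤ : ∀ {n} k (L : List (Subset n)) →
  Unique L → All (λ S → ∣ S ∣ ≤ k) L → length L ≤ suc n ^ k
Unique-subsets≤-length-≤ {n} k L u small =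
  ≤-trans (Unique⇒length-≤ u (λ S∈L → ∈-subsets≤ k _ (All.lookup small S∈L))) (length-subsets≤ n k)

MinZFSList-length-≤ : ∀ {n} {G : Graph n} {k} → ZbarAtMost G k →
  ∀ L → MinZFSList G L → length L ≤ suc n ^ k
MinZFSList-length-≤ {k = k} zbar L (u , minimal) =
  Unique-subsets≤-length-≤ k L u (All.map (zbar _) minimal)

^-distribʳ-* : ∀ m n k → (m * n) ^ k ≡ m ^ k * n ^ k
^-distribʳ-* m n zero    = refl
^-distribʳ-* m n (suc k) = begin
  m * n * (m * n) ^ k     ≡⟨ cong (m * n *_) (^-distribʳ-* m n k) ⟩
  m * n * (m ^ k * n ^ k) ≡⟨ interchange *-commutativeSemigroup m n (m ^ k) (n ^ k) ⟩
  m * m ^ k * (n * n ^ k) ∎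
  where open ≡-Reasoning

suc^≤2^*^ : ∀ {n} k → 1 ≤ n → suc n ^ k ≤ 2 ^ k * n ^ k
suc^≤2^*^ {n} k 1≤n = begin
  suc n ^ k     ≤⟨ ^-monoˡ-≤ k suc≤2* ⟩
  (2 * n) ^ k   ≡⟨ ^-distribʳ-* 2 n k ⟩
  2 ^ k * n ^ k ∎
  where
  open ≤-Reasoning
  suc≤2* : suc n ≤ 2 * n
  suc≤2* = begin
    suc n    ≡⟨ +-comm 1 n ⟩
    n + 1    ≤⟨ +-monoʳ-≤ n 1≤n ⟩
    n + n    ≡⟨ cong (n +_) (sym (+-identityʳ n)) ⟩
    2 * n    ∎

suc^≤2^*^+2^ : ∀ n k → suc n ^ k ≤ 2 ^ k * n ^ k + 2 ^ k
suc^≤2^*^+2^ zero    k = ≤-trans (≤-trans (≤-reflexive (^-zeroˡ k)) (m^n>0 2 k)) (m≤n+m _ _)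
suc^≤2^*^+2^ (suc n) k = ≤-trans (suc^≤2^*^ k (s≤s z≤n)) (m≤m+n _ _)

emptyGraph : ∀ n → Graph n
emptyGraph n = record { adj = λ _ _ → false ; symm = λ _ _ → refl ; irrefl = λ _ → refl }

Closure-emptyGraph : ∀ {n} {S : Subset n} {v} → Closure (emptyGraph n) S v → v ∈ₛ S
Closure-emptyGraph (init v∈S)    = v∈S
Closure-emptyGraph (force _ () _)

IsZFS-emptyGraph⇒≡⊤ : ∀ {n} {S : Subset n} → IsZeroForcingSet (emptyGraph n) S → S ≡ ⊤
IsZFS-emptyGraph⇒≡⊤ zfs = ⊆-antisym ⊆⊤ (λ {v} _ → Closure-emptyGraph (zfs v))

⊤-isMinimalZFS-emptyGraph : ∀ n → IsMinimalZFS (emptyGraph n) ⊤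
⊤-isMinimalZFS-emptyGraph n =
  (λ _ → init ∈⊤) , λ { T (_ , x , _ , x∉T) zfs → x∉T (Closure-emptyGraph (zfs x)) }

MinZFSList-emptyGraph-length-≤ : ∀ n L → MinZFSList (emptyGraph n) L → length L ≤ 1
MinZFSList-emptyGraph-length-≤ n []          _ = z≤n
MinZFSList-emptyGraph-length-≤ n (_ ∷ [])    _ = s≤s z≤n
MinZFSList-emptyGraph-length-≤ n (S ∷ S′ ∷ _) ((S≢S′ ∷ _) ∷ _ , (zfs , _) ∷ (zfs′ , _) ∷ _) =
  ⊥-elim (S≢S′ (trans (IsZFS-emptyGraph⇒≡⊤ zfs) (sym (IsZFS-emptyGraph⇒≡⊤ zfs′))))

module PerfectMatching {m} (σ : Fin m → Fin m)
  (σ-involutive : ∀ v → σ (σ v) ≡ v) (σ-fixedPointFree : ∀ v → σ v ≢ v) where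

  matching : Graph m
  matching = record
    { adj    = λ u v → ⌊ v ≟ σ u ⌋
    ; symm   = λ u v → begin
        ⌊ v ≟ σ u ⌋     ≡⟨ isYes≗does (v ≟ σ u) ⟩
        does (v ≟ σ u) ≡⟨ does-⇔ (mk⇔ (swap u v) (swap v u)) (v ≟ σ u) (u ≟ σ v) ⟩
        does (u ≟ σ v) ≡⟨ isYes≗does (u ≟ σ v) ⟨
        ⌊ u ≟ σ v ⌋     ∎
    ; irrefl = λ u → trans (isYes≗does (u ≟ σ u)) (dec-false (u ≟ σ u) (σ-fixedPointFree u ∘ sym))
    }
    where
    open ≡-Reasoning
    swap : ∀ u v → v ≡ σ u → u ≡ σ v
    swap u v refl = sym (σ-involutive u)

  Adj⇒≡σ : ∀ {u v} → Adj matching u v → v ≡ σ u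
  Adj⇒≡σ {u} {v} = toWitness {a? = v ≟ σ u}

  Adj-σ : ∀ u → Adj matching (σ u) u
  Adj-σ u = fromWitness {a? = u ≟ σ (σ u)} (sym (σ-involutive u))

  Closure⇒meets : ∀ {T v} → Closure matching T v → v ∈ₛ T ⊎ σ v ∈ₛ T
  Closure⇒meets (init v∈T) = inj₁ v∈T
  Closure⇒meets {T} (force {u} c adj _) with Adj⇒≡σ adj
  ... | refl with Closure⇒meets c
  ...   | inj₁ u∈T  = inj₂ (subst (_∈ₛ T) (sym (σ-involutive u)) u∈T)
  ...   | inj₂ σu∈T = inj₁ σu∈T

  meets⇒IsZFS : ∀ {S} → (∀ v → v ∈ₛ S ⊎ σ v ∈ₛ S) → IsZeroForcingSet matching S
  meets⇒IsZFS meets v with meets v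
  ... | inj₁ v∈S  = init v∈S
  ... | inj₂ σv∈S = force (init σv∈S) (Adj-σ v)
                      (λ w adj w≢v → ⊥-elim (w≢v (trans (Adj⇒≡σ adj) (σ-involutive v))))

  transversal⇒IsMinimalZFS : ∀ {S} → (∀ v → v ∈ₛ S ⊎ σ v ∈ₛ S) → (∀ v → v ∈ₛ S → σ v ∉ S) →
    IsMinimalZFS matching S
  transversal⇒IsMinimalZFS {S} meets once = meets⇒IsZFS meets , minimal
    where
    minimal : ∀ T → T ⊂ S → ¬ IsZeroForcingSet matching T
    minimal T (T⊆S , x , x∈S , x∉T) zfs with Closure⇒meets (zfs x)
    ... | inj₁ x∈T  = x∉T x∈T
    ... | inj₂ σx∈T = once x x∈S (T⊆S σx∈T)

double : ℕ → ℕ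
double zero    = zero
double (suc n) = suc (suc (double n))

double≡2* : ∀ n → double n ≡ 2 * n
double≡2* zero    = refl
double≡2* (suc n) = trans (cong (λ x → suc (suc x)) (double≡2* n)) (sym (*-suc 2 n))

pairSwap : ∀ n → Fin (double n) → Fin (double n)
pairSwap (suc n) zero          = suc zero
pairSwap (suc n) (suc zero)    = zero
pairSwap (suc n) (suc (suc v)) = suc (suc (pairSwap n v))

pairSwap-involutive : ∀ n v → pairSwap n (pairSwap n v) ≡ v
pairSwap-involutive (suc n) zero          = refl
pairSwap-involutive (suc n) (suc zero)    = refl
pairSwap-involutive (suc n) (suc (suc v)) = cong (λ x → suc (suc x)) (pairSwap-involutive n v)

pairSwap-fixedPointFree : ∀ n v → pairSwap n v ≢ v
pairSwap-fixedPointFree (suc n) zero          ()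
pairSwap-fixedPointFree (suc n) (suc zero)    ()
pairSwap-fixedPointFree (suc n) (suc (suc v)) eq =
  pairSwap-fixedPointFree n v (suc-injective (suc-injective eq))

module Matching n = PerfectMatching (pairSwap n) (pairSwap-involutive n) (pairSwap-fixedPointFree n)
open Matching using (matching)

transversal : ∀ n → Subset n → Subset (double n)
transversal zero    []      = []
transversal (suc n) (b ∷ c) = b ∷ not b ∷ transversal n c

transversal-meets : ∀ n c v → v ∈ₛ transversal n c ⊎ pairSwap n v ∈ₛ transversal n c
transversal-meets (suc n) (true  ∷ c) zero       = inj₁ here
transversal-meets (suc n) (false ∷ c) zero       = inj₂ (there here)
transversal-meets (suc n) (true  ∷ c) (suc zero) = inj₂ here
transversal-meets (suc n) (false ∷ c) (suc zero) = inj₁ (there here)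
transversal-meets (suc n) (b ∷ c) (suc (suc v)) with transversal-meets n c v
... | inj₁ v∈   = inj₁ (there (there v∈))
... | inj₂ σv∈  = inj₂ (there (there σv∈))

transversal-once : ∀ n c v → v ∈ₛ transversal n c → pairSwap n v ∉ transversal n c
transversal-once (suc n) (true  ∷ c) zero       here         (there ())
transversal-once (suc n) (false ∷ c) (suc zero) (there here) ()
transversal-once (suc n) (b ∷ c) (suc (suc v)) (there (there v∈)) (there (there σv∈)) =
  transversal-once n c v v∈ σv∈

∣transversal∣ : ∀ n c → ∣ transversal n c ∣ ≡ n
∣transversal∣ zero    []          = refl
∣transversal∣ (suc n) (true  ∷ c) = cong suc (∣transversal∣ n c)
∣transversal∣ (suc n) (false ∷ c) = cong suc (∣transversal∣ n c)

transversal-injective : ∀ n {c d} → transversal n c ≡ transversal n d → c ≡ d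
transversal-injective zero    {[]}    {[]}    _  = refl
transversal-injective (suc n) {_ ∷ _} {_ ∷ _} eq =
  cong₂ _∷_ (∷-injectiveˡ eq) (transversal-injective n (∷-injectiveʳ (∷-injectiveʳ eq)))

transversal-isMinimalZFS : ∀ n c → IsMinimalZFS (matching n) (transversal n c)
transversal-isMinimalZFS n c =
  Matching.transversal⇒IsMinimalZFS n (transversal-meets n c) (transversal-once n c)

allSubsets : ∀ n → List (Subset n)
allSubsets zero    = [] ∷ []
allSubsets (suc n) = map (true ∷_) (allSubsets n) ++ map (false ∷_) (allSubsets n)

length-allSubsets : ∀ n → length (allSubsets n) ≡ 2 ^ n
length-allSubsets zero    = refl
length-allSubsets (suc n) = begin
  length (map (true ∷_) (allSubsets n) ++ map (false ∷_) (allSubsets n))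
    ≡⟨ length-++ (map (true ∷_) (allSubsets n)) ⟩
  length (map (true ∷_) (allSubsets n)) + length (map (false ∷_) (allSubsets n))
    ≡⟨ cong₂ _+_ (length-map _ (allSubsets n)) (length-map _ (allSubsets n)) ⟩
  length (allSubsets n) + length (allSubsets n)
    ≡⟨ cong (λ l → l + l) (length-allSubsets n) ⟩
  2 ^ n + 2 ^ n
    ≡⟨ cong (2 ^ n +_) (+-identityʳ (2 ^ n)) ⟨
  2 ^ suc n ∎
  where open ≡-Reasoning

allSubsets-unique : ∀ n → Unique (allSubsets n)
allSubsets-unique zero    = [] ∷ []
allSubsets-unique (suc n) =
  ++⁺ (Unique-map⁺ ∷-injectiveʳ (allSubsets-unique n)) (Unique-map⁺ ∷-injectiveʳ (allSubsets-unique n)) disjoint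
  where
  disjoint : ∀ {S} → ¬ (S ∈ map (true ∷_) (allSubsets n) × S ∈ map (false ∷_) (allSubsets n))
  disjoint (S∈ , S∈′) with ∈-map⁻ (true ∷_) S∈ | ∈-map⁻ (false ∷_) S∈′
  ... | _ , _ , refl | _ , _ , ()

transversals : ∀ n → List (Subset (double n))
transversals n = map (transversal n) (allSubsets n)

length-transversals : ∀ n → length (transversals n) ≡ 2 ^ n
length-transversals n = trans (length-map (transversal n) (allSubsets n)) (length-allSubsets n)

transversals-minZFSList : ∀ n → MinZFSList (matching n) (transversals n)
transversals-minZFSList n =
  Unique-map⁺ (transversal-injective n) (allSubsets-unique n) ,
  All-map⁺ (All.universal (transversal-isMinimalZFS n) (allSubsets n))

4^double≤3^double*2^ : ∀ n → 4 ^ double n ≤ 3 ^ double n * 2 ^ n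
4^double≤3^double*2^ n = begin
  4 ^ double n          ≡⟨ cong (4 ^_) (double≡2* n) ⟩
  4 ^ (2 * n)           ≡⟨ ^-*-assoc 4 2 n ⟨
  16 ^ n                ≤⟨ ^-monoˡ-≤ n (+-monoʳ-≤ 16 z≤n) ⟩
  (9 * 2) ^ n           ≡⟨ ^-distribʳ-* 9 2 n ⟩
  9 ^ n * 2 ^ n         ≡⟨ cong (_* 2 ^ n) (^-*-assoc 3 2 n) ⟩
  3 ^ (2 * n) * 2 ^ n   ≡⟨ cong (λ e → 3 ^ e * 2 ^ n) (double≡2* n) ⟨
  3 ^ double n * 2 ^ n  ∎
  where open ≤-Reasoning

proposition2p1 :
    (∀ (k : ℕ) → 1 ≤ k →
      ∃ λ (C : ℕ) → ∃ λ (N : ℕ) →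
        ∀ (n : ℕ) → N ≤ n → (G : Graph n) → ZbarAtMost G k →
          ∀ (L : List (Subset n)) → MinZFSList G L → length L ≤ C * n ^ k)
    ×
    (∀ (m : ℕ → ℕ) (G : (i : ℕ) → Graph (m i)) →
      (∃ λ (k : ℕ) → ∀ i → ZbarAtMost (G i) k) →
      ∃ λ (d : ℕ) → ∃ λ (C : ℕ) → ∀ i →
        ∀ (L : List (Subset (m i))) → MinZFSList (G i) L →
          length L ≤ C * m i ^ d + C)
    ×
    (Σ (ℕ → ℕ) λ m → Σ ((i : ℕ) → Graph (m i)) λ G →
      (∀ i → m i < m (suc i)) ×
      (∃ λ (c : ℕ) → 1 ≤ c × ∃ λ (N : ℕ) → ∀ i → N ≤ i →
         Σ ℕ λ z → ZbarAtLeast (G i) z × m i ≤ c * z) ×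
      (∃ λ (d : ℕ) → ∃ λ (C : ℕ) → ∀ i →
         ∀ (L : List (Subset (m i))) → MinZFSList (G i) L →
           length L ≤ C * m i ^ d + C))
    ×
    (Σ (ℕ → ℕ) λ m → Σ ((i : ℕ) → Graph (m i)) λ G →
      (∀ i → m i < m (suc i)) ×
      (∃ λ (c : ℕ) → 1 ≤ c × ∃ λ (N : ℕ) → ∀ i → N ≤ i →
         Σ ℕ λ z → ZbarAtLeast (G i) z × m i ≤ c * z) ×
      (∃ λ (p : ℕ) → ∃ λ (q : ℕ) → q < p × ∃ λ (N : ℕ) → ∀ i → N ≤ i →
         Σ (List (Subset (m i))) λ L → MinZFSList (G i) L ×
           p ^ m i ≤ q ^ m i * length L))
proposition2p1 =
    (λ k _ → 2 ^ k , 1 , λ n 1≤n G zbar L ok →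
       ≤-trans (MinZFSList-length-≤ zbar L ok) (suc^≤2^*^ k 1≤n))
  , (λ m G (k , zbar) → k , 2 ^ k , λ i L ok →
       ≤-trans (MinZFSList-length-≤ (zbar i) L ok) (suc^≤2^*^+2^ (m i) k))
  , ((λ i → i) , emptyGraph , (λ _ → ≤-refl)
    , (1 , ≤-refl , 0 , λ i _ → i , (⊤ , ⊤-isMinimalZFS-emptyGraph i , ≤-reflexive (sym (∣⊤∣≡n i)))
                                    , ≤-reflexive (sym (*-identityˡ i)))
    , (0 , 1 , λ i L ok → ≤-trans (MinZFSList-emptyGraph-length-≤ i L ok) (n≤1+n 1)))
  , (double , matching , (λ i → n≤1+n (suc (double i)))
    , (2 , s≤s z≤n , 0 , λ i _ → i , (transversal i ⊤ , transversal-isMinimalZFS i ⊤ , ≤-reflexive (sym (∣transversal∣ i ⊤)))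
                                    , ≤-reflexive (double≡2* i))
    , (4 , 3 , ≤-refl , 0 , λ i _ → transversals i , transversals-minZFSList i
      , ≤-trans (4^double≤3^double*2^ i) (≤-reflexive (cong (3 ^ double i *_) (sym (length-transversals i))))))
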